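{- (Heine–Borel Theorem for Lowercuts; intuitionistic logic.) Let $a,b\in\mathbb Q$, $A$ a type and $q,r:A\to\mathbb Q$ families satisfying CovL. Then there exist $n\in\mathbb N$ and $F:[n]\to A$ such that CovL also holds for $a,b$ and the families $q\circ F,r\circ F:[n]\to\mathbb Q$.
   Context: Intuitionistic logic with an impredicative type of propositions. A lowercut is $L\subseteq\mathbb Q$ that is a lower set ($a<b\wedge b\in L\to a\in L$) and upwards-open ($a\in L\to\exists b,(a<b\wedge b\in L)$). For a lowercut $L$, $\overline L:=\{q\in\mathbb Q\mid\forall r,(r<q\to r\in L)\}$. $[n]$ denotes the set of naturals below $n$. CovL for rationals $a,b$ and families $q,r:B\to\mathbb Q$ indexed by a type $B$: for every lowercut $L$, if $q_\beta\in L\to r_\beta\in\overline L$ holds for all $\beta:B$, then $a\in\overline L\to b\in L$. -}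

module Defs where

open import Level using (Level; _⊔_) renaming (suc to lsuc; zero to lzero)
open import Data.Rational using (ℚ; _<_)
open import Data.Product using (Σ; _×_; ∃-syntax)

record IsLowercut {ℓ : Level} (L : ℚ → Set ℓ) : Set ℓ where
  field
    lower : ∀ (a b : ℚ) → a < b → L b → L a
    upOpen : ∀ (a : ℚ) → L a → ∃[ b ] (a < b × L b)

closure : ∀ {ℓ} → (ℚ → Set ℓ) → ℚ → Set ℓ
closure L q = ∀ (r : ℚ) → r < q → L r

CovL : (ℓ : Level) {b : Level} {B : Set b} → ℚ → ℚ → (B → ℚ) → (B → ℚ)
     → Set (lsuc ℓ ⊔ b)
CovL ℓ {B = B} a b q r =
  ∀ (L : ℚ → Set ℓ) → IsLowercut L →
  (∀ (β : B) → L (q β) → closure L (r β)) →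
  closure L a → L b

{-# OPTIONS --safe #-}
-- Call x finitely covered when CovL holds for a, x and some finite subfamily.
-- The points strictly below a finitely covered point form a lowercut L, one
-- universe up (hence the hypothesis at every level). Every x < a is covered by
-- the empty family, and if q β ∈ L then adjoining β covers every point below
-- r β, so the hypotheses of CovL hold for L and CovL for the whole family gives
-- b ∈ L. Since CovL is downward closed in its right endpoint, b itself is
-- finitely covered.
module Submission where

open import Defs
open import Level using (Level) renaming (suc to lsuc)
open import Data.Nat using (suc)
open import Data.Fin using (Fin; zero; suc)
open import Data.Vec.Functional using ([]; _∷_)
open import Data.Rational using (ℚ; _<_)
open import Data.Rational.Properties using (<-dense; <-trans)
open import Data.Product using (Σ; ∃-syntax; _,_; _×_)
open import Function using (_∘_)

Below : ∀ {ℓ} → (ℚ → Set ℓ) → ℚ → Set ℓ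
Below P x = ∃[ y ] (x < y × P y)

Below-isLowercut : ∀ {ℓ} (P : ℚ → Set ℓ) → IsLowercut (Below P)
Below-isLowercut P = record
  { lower = λ x x′ x<x′ (y , x′<y , py) → y , <-trans x<x′ x′<y , py
  ; upOpen = λ x (y , x<y , py) →
      let (m , x<m , m<y) = <-dense x<y in m , x<m , y , m<y , py
  }

closure⇒closure-Below : ∀ {ℓ} {P : ℚ → Set ℓ} {c : ℚ} →
                        closure P c → closure (Below P) c
closure⇒closure-Below cl x x<c =
  let (m , x<m , m<c) = <-dense x<c in m , x<m , cl m m<c

module _ {ℓ b : Level} {B : Set b} {q r : B → ℚ} where

  CovL-below-left : ∀ {a x} → x < a → CovL ℓ a x q r
  CovL-below-left x<a L _ _ cla = cla _ x<a

  CovL-lower : ∀ {a x y} → x < y → CovL ℓ a y q r → CovL ℓ a x q r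
  CovL-lower x<y cov L isL hyps cla = IsLowercut.lower isL _ _ x<y (cov L isL hyps cla)

module _ {ℓ : Level} {A : Set} (q r : A → ℚ) where

  CovL-∷ : ∀ {a y m n} {F : Fin n → A} {β : A} →
           CovL ℓ a y (q ∘ F) (r ∘ F) → q β < y → m < r β →
           CovL ℓ a m (q ∘ (β ∷ F)) (r ∘ (β ∷ F))
  CovL-∷ cov qβ<y m<rβ L isL hyps cla =
    hyps zero (IsLowercut.lower isL _ _ qβ<y (cov L isL (hyps ∘ suc) cla)) _ m<rβ

  FinitelyCovered : ℚ → ℚ → Set (lsuc ℓ)
  FinitelyCovered a x = ∃[ n ] Σ (Fin n → A) (λ F → CovL ℓ a x (q ∘ F) (r ∘ F))

corollary38 : ∀ (ℓ : Level) (a b : ℚ) (A : Set) (q r : A → ℚ)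
            → (∀ (ℓ' : Level) → CovL ℓ' a b q r)
            → ∃[ n ] Σ (Fin n → A) (λ F → CovL ℓ a b (q ∘ F) (r ∘ F))
corollary38 ℓ a b A q r cov =
  let (_ , b<y , n , F , covF) =
        cov (lsuc ℓ) (Below Covered) (Below-isLowercut Covered) adjoin covered-below-a
  in n , F , CovL-lower b<y covF
  where
  Covered : ℚ → Set (lsuc ℓ)
  Covered = FinitelyCovered {ℓ} q r a

  covered-below-a : closure (Below Covered) a
  covered-below-a = closure⇒closure-Below (λ x x<a → 0 , [] , CovL-below-left x<a)

  adjoin : ∀ β → Below Covered (q β) → closure (Below Covered) (r β)
  adjoin β (_ , qβ<y , n , F , covF) = closure⇒closure-Below λ m m<rβ →
    suc n , β ∷ F , CovL-∷ q r covF qβ<y m<rβ
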